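{- For all integers $n,m\geq 3$, $$\beta(K_n\,\square\,K_m)=2+\min\{\beta(K_{n-2}\,\square\,K_{m-1}),\ \beta(K_{n-1}\,\square\,K_{m-2})\}.$$
   Context: $K_n$ is the complete graph on $n$ vertices. $d(v,w)$ denotes shortest-path distance. A vertex $x$ resolves $v,w$ if $d(v,x)\neq d(w,x)$; a set resolves a graph if every pair of distinct vertices is resolved by some vertex of the set; $\beta(G)$ is the minimum size of a resolving set. The cartesian product $G\,\square\,H$ has vertex set $V(G)\times V(H)$, with $(a,v)\sim(b,w)$ iff ($a=b$ and $vw\in E(H)$) or ($v=w$ and $ab\in E(G)$). -}

module Defs where

open import Level using (0ℓ)
open import Data.Nat using (ℕ; zero; suc; _≤_)
open import Data.Fin using (Fin)
open import Data.Product using (_×_; _,_; ∃; ∃-syntax)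
open import Data.List using (List; length)
open import Data.List.Membership.Propositional using (_∈_)
open import Data.List.Relation.Unary.Any using (Any)
open import Data.List.Relation.Unary.Unique.Propositional using (Unique)
open import Data.Sum using (_⊎_)
open import Relation.Binary.PropositionalEquality using (_≡_; _≢_)

record Graph : Set₁ where
  field
    V   : Set
    Adj : V → V → Set
open Graph public

data Walk (G : Graph) : V G → V G → ℕ → Set where
  here : ∀ {u} → Walk G u u zero
  step : ∀ {u w v k} → Adj G u w → Walk G w v k → Walk G u v (suc k)

Dist : (G : Graph) → V G → V G → ℕ → Set
Dist G u v k = Walk G u v k × (∀ j → Walk G u v j → k ≤ j)

Resolves : (G : Graph) → V G → V G → V G → Set
Resolves G x v w = ∃[ k₁ ] ∃[ k₂ ] (Dist G v x k₁ × Dist G w x k₂ × k₁ ≢ k₂)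

IsResolvingSet : (G : Graph) → List (V G) → Set
IsResolvingSet G S = ∀ v w → v ≢ w → Any (λ x → Resolves G x v w) S

IsMetricDim : (G : Graph) → ℕ → Set
IsMetricDim G b =
  (∃[ S ] (Unique S × IsResolvingSet G S × length S ≡ b))
  × (∀ S → Unique S → IsResolvingSet G S → b ≤ length S)

K : ℕ → Graph
K n = record { V = Fin n ; Adj = λ a b → a ≢ b }

_□_ : Graph → Graph → Graph
G □ H = record
  { V = V G × V H
  ; Adj = λ { (a , v) (b , w) → (a ≡ b × Adj H v w) ⊎ (v ≡ w × Adj G a b) } }

{-# OPTIONS --safe #-}
-- In K n □ K m the distance is the Hamming distance of the two coordinates. Call k
-- admissible for n × m when 2(n + m) ≤ 3k + 4, n ≤ k + 1 and m ≤ k + 1; then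
-- β(K n □ K m) is the least admissible k.
--
-- Lower bound: in a resolving set at most one row and at most one column are empty, at
-- most one landmark is lonely (alone in its row and in its column), and there is none
-- if some row and some column are both empty. Let every landmark hand 6 units to its
-- row and its column, split between them by share. Each non-empty line then receives
-- at least 4 units, except the two lines of a lonely landmark, which receive 3;
-- counting gives 4(n + m) ≤ 6k + 8, and n, m ≤ k + 1 since at most one line is empty.
--
-- Upper bound: adding two rows and one column carrying the two new landmarks (0 , 0)
-- and (1 , 0) turns a resolving set of K n □ K m into one of K (n + 2) □ K (m + 1).
-- Applying this along the longer side, starting from a single line or from K 2 □ K 2,
-- reaches every admissible size.
--
-- Finally, for n, m ≥ 3, k + 2 is admissible for n × m exactly when k is admissible
-- for (n − 2) × (m − 1) or for (n − 1) × (m − 2), which is the recursion.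
module Submission where

open import Defs
open import Data.Nat using (ℕ; zero; suc; _≤_; _<_; _+_; _*_; _∸_; _⊓_; z≤n; s≤s; s≤s⁻¹; z<s; _≤?_)
open import Data.Nat.Properties hiding (_≟_)
open import Data.Fin using (Fin; zero; suc; _≟_)
import Data.Fin.Properties as Finₚ
open import Data.Product using (_×_; _,_; proj₁; proj₂; swap; uncurry; ∃-syntax)
open import Data.Sum using (_⊎_; inj₁; inj₂)
open import Data.List using (List; []; _∷_; map; length; allFin)
open import Data.List.Properties using (length-map; length-tabulate)
open import Data.List.Relation.Unary.Any using (Any; here; there)
import Data.List.Relation.Unary.Any as Any
import Data.List.Relation.Unary.Any.Properties as Any
import Data.List.Relation.Unary.All as All
import Data.List.Relation.Unary.All.Properties as All
open import Data.List.Relation.Unary.All using ([]; _∷_)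
open import Data.List.Relation.Unary.AllPairs using ([]; _∷_)
open import Data.List.Relation.Unary.Unique.Propositional using (Unique)
import Data.List.Relation.Unary.Unique.Propositional.Properties as Unique
open import Data.List.Membership.Propositional using (_∈_; find)
open import Data.List.Membership.Propositional.Properties using (∈-map⁺; ∈-allFin)
open import Function using (_∘_; id)
open import Data.Nat.Tactic.RingSolver using (solve-∀)
open import Algebra.Properties.Semiring.Sum +-*-semiring
  using (sum; ∑-distrib-+; ∑-comm; sum-cong-≗; *-distribˡ-sum; sum-replicate-zero)
open import Relation.Binary.PropositionalEquality
open import Relation.Nullary using (¬_; yes; no; contradiction)
open import Data.Empty using (⊥; ⊥-elim)

sum-mono-≤ : ∀ {n} {f g : Fin n → ℕ} → (∀ i → f i ≤ g i) → sum f ≤ sum g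
sum-mono-≤ {zero}  _   = z≤n
sum-mono-≤ {suc n} f≤g = +-mono-≤ (f≤g zero) (sum-mono-≤ (f≤g ∘ suc))

sum-const : ∀ n k → sum {n} (λ _ → k) ≡ n * k
sum-const zero    k = refl
sum-const (suc n) k = cong (k +_) (sum-const n k)

sum-zero : ∀ {n} {f : Fin n → ℕ} → (∀ i → f i ≡ 0) → sum f ≡ 0
sum-zero {n} f≡0 = trans (sum-cong-≗ f≡0) (sum-replicate-zero n)

entry≤sum : ∀ {n} (f : Fin n → ℕ) i → f i ≤ sum f
entry≤sum f zero    = m≤m+n (f zero) _
entry≤sum f (suc i) = ≤-trans (entry≤sum (f ∘ suc) i) (m≤n+m _ (f zero))

two-entries≤sum : ∀ {n} (f : Fin n → ℕ) {i j} → i ≢ j → f i + f j ≤ sum f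
two-entries≤sum f {zero}  {zero}  i≢j = contradiction refl i≢j
two-entries≤sum f {zero}  {suc j} _   = +-monoʳ-≤ (f zero) (entry≤sum (f ∘ suc) j)
two-entries≤sum f {suc i} {zero}  _   =
  ≤-trans (≤-reflexive (+-comm (f (suc i)) (f zero))) (+-monoʳ-≤ (f zero) (entry≤sum (f ∘ suc) i))
two-entries≤sum f {suc i} {suc j} i≢j = ≤-trans (two-entries≤sum (f ∘ suc) (i≢j ∘ cong suc)) (m≤n+m _ (f zero))

sum≡0⇒≡0 : ∀ {n} (f : Fin n → ℕ) → sum f ≡ 0 → ∀ i → f i ≡ 0
sum≡0⇒≡0 f sum≡0 i = n≤0⇒n≡0 (≤-trans (entry≤sum f i) (≤-reflexive sum≡0))

sum≡1⇒support-unique : ∀ {n} (f : Fin n → ℕ) → sum f ≡ 1 → ∀ {i j} → 0 < f i → 0 < f j → i ≡ j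
sum≡1⇒support-unique f sum≡1 {i} {j} 0<fi 0<fj with i ≟ j
... | yes i≡j = i≡j
... | no  i≢j = contradiction
  (≤-trans (+-mono-≤ 0<fi 0<fj) (≤-trans (two-entries≤sum f i≢j) (≤-reflexive sum≡1))) λ { (s≤s ()) }

sum-positive : ∀ {n} (f : Fin n → ℕ) → 0 < sum f → ∃[ i ] 0 < f i
sum-positive {suc n} f 0<sum with f zero in eq
... | suc _ = zero , subst (0 <_) (sym eq) z<s
... | zero  = let i , 0<fi = sum-positive (f ∘ suc) 0<sum in suc i , 0<fi

sum≤1 : ∀ {n} (f : Fin n → ℕ) → (∀ i → f i ≤ 1) → (∀ {i j} → 0 < f i → 0 < f j → i ≡ j) → sum f ≤ 1
sum≤1 {zero}  f _   _      = z≤n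
sum≤1 {suc n} f f≤1 unique with f zero in eq
... | zero  = sum≤1 (f ∘ suc) (f≤1 ∘ suc) (λ p q → Finₚ.suc-injective (unique p q))
... | suc k = begin
  suc k + sum (f ∘ suc) ≡⟨ cong₂ _+_ (sym eq) (sum-zero rest) ⟩
  f zero + 0            ≡⟨ +-identityʳ (f zero) ⟩
  f zero                ≤⟨ f≤1 zero ⟩
  1                     ∎
  where
  open ≤-Reasoning
  rest : ∀ i → f (suc i) ≡ 0
  rest i with f (suc i) in eq′
  ... | zero  = refl
  ... | suc _ = contradiction (unique (subst (0 <_) (sym eq) z<s) (subst (0 <_) (sym eq′) z<s)) λ ()

kronecker : ∀ {n} → Fin n → Fin n → ℕ
kronecker zero    zero    = 1
kronecker zero    (suc _) = 0
kronecker (suc _) zero    = 0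
kronecker (suc a) (suc b) = kronecker a b

kronecker-refl : ∀ {n} (a : Fin n) → kronecker a a ≡ 1
kronecker-refl zero    = refl
kronecker-refl (suc a) = kronecker-refl a

sum-kronecker : ∀ {n} (a : Fin n) → sum (kronecker a) ≡ 1
sum-kronecker {suc n} zero    = cong suc (sum-replicate-zero n)
sum-kronecker         (suc a) = sum-kronecker a

-- Distances in K n □ K m

distK : ∀ {n} → Fin n → Fin n → ℕ
distK zero    zero    = 0
distK zero    (suc _) = 1
distK (suc _) zero    = 1
distK (suc a) (suc b) = distK a b

distK-refl : ∀ {n} (a : Fin n) → distK a a ≡ 0
distK-refl zero    = refl
distK-refl (suc a) = distK-refl a

distK-≢ : ∀ {n} {a b : Fin n} → a ≢ b → distK a b ≡ 1
distK-≢ {a = zero}  {zero}  a≢b = contradiction refl a≢b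
distK-≢ {a = zero}  {suc b} _   = refl
distK-≢ {a = suc a} {zero}  _   = refl
distK-≢ {a = suc a} {suc b} a≢b = distK-≢ (a≢b ∘ cong suc)

distK≤1 : ∀ {n} (a b : Fin n) → distK a b ≤ 1
distK≤1 zero    zero    = z≤n
distK≤1 zero    (suc _) = ≤-refl
distK≤1 (suc _) zero    = ≤-refl
distK≤1 (suc a) (suc b) = distK≤1 a b

distK≤1+ : ∀ {n c} (a b : Fin n) → distK a b ≤ suc c
distK≤1+ a b = ≤-trans (distK≤1 a b) (s≤s z≤n)

distK≡0⇒≡ : ∀ {n} {a b : Fin n} → distK a b ≡ 0 → a ≡ b
distK≡0⇒≡ {a = zero}  {zero}  _ = refl
distK≡0⇒≡ {a = suc a} {suc b} d = cong suc (distK≡0⇒≡ d)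

walkK : ∀ {n} (a b : Fin n) → Walk (K n) a b (distK a b)
walkK a b with a ≟ b
... | yes refl = subst (Walk (K _) a a) (sym (distK-refl a)) here
... | no a≢b   = subst (Walk (K _) a b) (sym (distK-≢ a≢b)) (step a≢b here)

map-walk : ∀ {G H : Graph} (f : V G → V H) → (∀ {u w} → Adj G u w → Adj H (f u) (f w)) →
  ∀ {u v k} → Walk G u v k → Walk H (f u) (f v) k
map-walk f f-adj here       = here
map-walk f f-adj (step a p) = step (f-adj a) (map-walk f f-adj p)

_++ʷ_ : ∀ {G u w v k l} → Walk G u w k → Walk G w v l → Walk G u v (k + l)
here     ++ʷ q = q
step a p ++ʷ q = step a (p ++ʷ q)

hamming : ∀ {n m} → Fin n × Fin m → Fin n × Fin m → ℕ
hamming (i , j) (a , b) = distK i a + distK j b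

hamming-refl : ∀ {n m} (v : Fin n × Fin m) → hamming v v ≡ 0
hamming-refl (i , j) = cong₂ _+_ (distK-refl i) (distK-refl j)

hamming≡0⇒≡ : ∀ {n m} {v w : Fin n × Fin m} → hamming v w ≡ 0 → v ≡ w
hamming≡0⇒≡ {v = i , j} {a , b} d =
  cong₂ _,_ (distK≡0⇒≡ (m+n≡0⇒m≡0 _ d)) (distK≡0⇒≡ (m+n≡0⇒n≡0 (distK i a) d))

module _ {n m : ℕ} where

  private
    G : Graph
    G = K n □ K m

  hamming-adj : ∀ {u w} v → Adj G u w → hamming u v ≤ suc (hamming w v)
  hamming-adj {i , j} {.i , j′} (a , b) (inj₁ (refl , _)) = begin
    distK i a + distK j b        ≤⟨ +-monoʳ-≤ (distK i a) (distK≤1+ j b) ⟩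
    distK i a + suc (distK j′ b) ≡⟨ +-suc (distK i a) (distK j′ b) ⟩
    suc (distK i a + distK j′ b) ∎
    where open ≤-Reasoning
  hamming-adj {i , j} {i′ , .j} (a , b) (inj₂ (refl , _)) = +-monoˡ-≤ (distK j b) (distK≤1+ i a)

  hamming≤walk : ∀ {u v k} → Walk G u v k → hamming u v ≤ k
  hamming≤walk {u} here       = ≤-reflexive (hamming-refl u)
  hamming≤walk {v = v} (step a p) = ≤-trans (hamming-adj v a) (s≤s (hamming≤walk p))

  walk-hamming : ∀ u v → Walk G u v (hamming u v)
  walk-hamming (i , j) (a , b) =
    map-walk (_, j) (λ i≢a → inj₂ (refl , i≢a)) (walkK i a) ++ʷ
    map-walk (a ,_) (λ j≢b → inj₁ (refl , j≢b)) (walkK j b)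

  Dist⇒≡hamming : ∀ {u v k} → Dist G u v k → k ≡ hamming u v
  Dist⇒≡hamming {u} {v} (p , shortest) = ≤-antisym (shortest _ (walk-hamming u v)) (hamming≤walk p)

  Dist-hamming : ∀ u v → Dist G u v (hamming u v)
  Dist-hamming u v = walk-hamming u v , λ _ → hamming≤walk

-- Resolving sets and their constructions

Separates : ∀ {n m} → Fin n × Fin m → Fin n × Fin m → Fin n × Fin m → Set
Separates v w x = hamming v x ≢ hamming w x

Resolving : ∀ {n m} → List (Fin n × Fin m) → Set
Resolving S = ∀ v w → v ≢ w → Any (Separates v w) S

Resolving⇒IsResolvingSet : ∀ {n m} {S : List (Fin n × Fin m)} → Resolving S → IsResolvingSet (K n □ K m) S
Resolving⇒IsResolvingSet R v w v≢w =
  Any.map (λ {x} sep → hamming v x , hamming w x , Dist-hamming v x , Dist-hamming w x , sep) (R v w v≢w)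

IsResolvingSet⇒Resolving : ∀ {n m} {S : List (Fin n × Fin m)} → IsResolvingSet (K n □ K m) S → Resolving S
IsResolvingSet⇒Resolving R v w v≢w = Any.map separates (R v w v≢w)
  where
  separates : ∀ {x} → Resolves (K _ □ K _) x v w → Separates v w x
  separates (_ , _ , d₁ , d₂ , k₁≢k₂) eq =
    k₁≢k₂ (trans (Dist⇒≡hamming d₁) (trans eq (sym (Dist⇒≡hamming d₂))))

separates-self : ∀ {n m} {v w : Fin n × Fin m} → v ≢ w → Separates v w v
separates-self {v = v} v≢w eq = v≢w (sym (hamming≡0⇒≡ (trans (sym eq) (hamming-refl v))))

separates-other : ∀ {n m} {v w : Fin n × Fin m} → v ≢ w → Separates v w w
separates-other v≢w = separates-self (v≢w ∘ sym) ∘ sym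

∈⇒separates : ∀ {n m} {S : List (Fin n × Fin m)} {v w} → v ∈ S → v ≢ w → Any (Separates v w) S
∈⇒separates v∈S v≢w = Any.map (λ { refl → separates-self v≢w }) v∈S

∈⇒separates-other : ∀ {n m} {S : List (Fin n × Fin m)} {v w} → w ∈ S → v ≢ w → Any (Separates v w) S
∈⇒separates-other w∈S v≢w = Any.map (λ { refl → separates-other v≢w }) w∈S

record ResolvingSet≤ (n m k : ℕ) : Set where
  field
    landmarks : List (Fin n × Fin m)
    unique    : Unique landmarks
    resolving : Resolving landmarks
    size≤     : length landmarks ≤ k

open ResolvingSet≤

widen : ∀ {n m k l} → k ≤ l → ResolvingSet≤ n m k → ResolvingSet≤ n m l
widen k≤l S = record
  { landmarks = landmarks S ; unique = unique S ; resolving = resolving S ; size≤ = ≤-trans (size≤ S) k≤l }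

hamming-swap : ∀ {n m} (v : Fin m × Fin n) x → hamming v (swap x) ≡ hamming (swap v) x
hamming-swap (j , i) (a , b) = +-comm (distK j b) (distK i a)

separates-swap : ∀ {n m} {v w : Fin m × Fin n} {x} → Separates (swap v) (swap w) x → Separates v w (swap x)
separates-swap {v = v} {w} {x} sep eq = sep (begin
  hamming (swap v) x ≡⟨ hamming-swap v x ⟨
  hamming v (swap x) ≡⟨ eq ⟩
  hamming w (swap x) ≡⟨ hamming-swap w x ⟩
  hamming (swap w) x ∎)
  where open ≡-Reasoning

transpose : ∀ {n m k} → ResolvingSet≤ n m k → ResolvingSet≤ m n k
transpose S = record
  { landmarks = map swap (landmarks S)
  ; unique    = Unique.map⁺ (cong swap) (unique S)
  ; resolving = λ v w v≢w →
      Any.map⁺ (Any.map (separates-swap {v = v} {w}) (resolving S (swap v) (swap w) (v≢w ∘ cong swap)))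
  ; size≤     = ≤-trans (≤-reflexive (length-map swap (landmarks S))) (size≤ S)
  }

line : ∀ m → ResolvingSet≤ 1 (suc m) m
line m = record
  { landmarks = map column (allFin m)
  ; unique    = Unique.map⁺ (λ { refl → refl }) (Unique.allFin⁺ m)
  ; resolving = resolves
  ; size≤     = ≤-reflexive (trans (length-map column (allFin m)) (length-tabulate id))
  }
  where
  column : Fin m → Fin 1 × Fin (suc m)
  column j = zero , suc j
  resolves : Resolving (map column (allFin m))
  resolves (zero , suc j) w              v≢w = ∈⇒separates (∈-map⁺ column (∈-allFin j)) v≢w
  resolves (zero , zero)  (zero , suc j) v≢w = ∈⇒separates-other (∈-map⁺ column (∈-allFin j)) v≢w
  resolves (zero , zero)  (zero , zero)  v≢w = contradiction refl v≢w

square : ResolvingSet≤ 2 2 2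
square = record
  { landmarks = (zero , zero) ∷ (zero , suc zero) ∷ []
  ; unique    = ((λ ()) ∷ []) ∷ [] ∷ []
  ; resolving = resolves
  ; size≤     = ≤-refl
  }
  where
  resolves : Resolving ((zero , zero) ∷ (zero , suc zero) ∷ [])
  resolves (zero , zero)     w v≢w = here (separates-self v≢w)
  resolves (zero , suc zero) w v≢w = there (here (separates-self v≢w))
  resolves v (zero , zero)     v≢w = here (separates-other v≢w)
  resolves v (zero , suc zero) v≢w = there (here (separates-other v≢w))
  resolves (suc zero , zero)     (suc zero , suc zero) _ = here (λ ())
  resolves (suc zero , suc zero) (suc zero , zero)     _ = here (λ ())
  resolves (suc zero , zero)     (suc zero , zero)     v≢w = contradiction refl v≢w
  resolves (suc zero , suc zero) (suc zero , suc zero) v≢w = contradiction refl v≢w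

module _ {n m : ℕ} where

  shift : Fin n × Fin m → Fin (2 + n) × Fin (suc m)
  shift (i , j) = suc (suc i) , suc j

  extend : List (Fin n × Fin m) → List (Fin (2 + n) × Fin (suc m))
  extend S = (zero , zero) ∷ (suc zero , zero) ∷ map shift S

module _ {n m : ℕ} {S : List (Fin (suc n) × Fin (suc m))} (R : Resolving S) where

  private
    shifted-rows : ∀ {i i′} b → i ≢ i′ → Any (Separates (suc (suc i) , b) (suc (suc i′) , b)) (map shift S)
    shifted-rows {i} {i′} b i≢i′ = Any.map⁺ (Any.map
      (λ {(a , c)} sep eq → sep (cong (_+ distK zero c) (+-cancelʳ-≡ (distK b (suc c)) _ _ eq)))
      (R (i , zero) (i′ , zero) (i≢i′ ∘ cong proj₁)))

    shifted-columns : ∀ {j j′} a → j ≢ j′ → Any (Separates (a , suc j) (a , suc j′)) (map shift S)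
    shifted-columns {j} {j′} a j≢j′ = Any.map⁺ (Any.map
      (λ {(c , d)} sep eq → sep (cong (distK zero c +_) (+-cancelˡ-≡ (distK a (suc (suc c))) _ _ eq)))
      (R (zero , j) (zero , j′) (j≢j′ ∘ cong proj₂)))

  extend-resolving : Resolving (extend S)
  extend-resolving (zero , zero)     w v≢w = here (separates-self v≢w)
  extend-resolving (suc zero , zero) w v≢w = there (here (separates-self v≢w))
  extend-resolving v (zero , zero)     v≢w = here (separates-other v≢w)
  extend-resolving v (suc zero , zero) v≢w = there (here (separates-other v≢w))
  extend-resolving (suc (suc i) , zero) (suc (suc i′) , zero) v≢w =
    there (there (shifted-rows zero (v≢w ∘ cong (λ i → suc (suc i) , zero))))
  extend-resolving (zero , suc j) (zero , suc j′) v≢w =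
    there (there (shifted-columns zero (v≢w ∘ cong (λ j → zero , suc j))))
  extend-resolving (suc zero , suc j) (suc zero , suc j′) v≢w =
    there (there (shifted-columns (suc zero) (v≢w ∘ cong (λ j → suc zero , suc j))))
  extend-resolving (suc (suc i) , suc j) (suc (suc i′) , suc j′) v≢w =
    there (there (Any.map⁺ (R (i , j) (i′ , j′) (v≢w ∘ cong shift))))
  -- In the remaining cases one of the two new landmarks separates.
  extend-resolving (suc (suc _) , zero)  (zero , suc _)         _ = there (here (λ ()))
  extend-resolving (suc (suc _) , zero)  (suc zero , suc _)     _ = here (λ ())
  extend-resolving (suc (suc _) , zero)  (suc (suc _) , suc _)  _ = here (λ ())
  extend-resolving (zero , suc _)        (suc (suc _) , zero)   _ = there (here (λ ()))
  extend-resolving (zero , suc _)        (suc zero , suc _)     _ = here (λ ())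
  extend-resolving (zero , suc _)        (suc (suc _) , suc _)  _ = here (λ ())
  extend-resolving (suc zero , suc _)    (suc (suc _) , zero)   _ = here (λ ())
  extend-resolving (suc zero , suc _)    (zero , suc _)         _ = here (λ ())
  extend-resolving (suc zero , suc _)    (suc (suc _) , suc _)  _ = there (here (λ ()))
  extend-resolving (suc (suc _) , suc _) (suc (suc _) , zero)   _ = here (λ ())
  extend-resolving (suc (suc _) , suc _) (zero , suc _)         _ = here (λ ())
  extend-resolving (suc (suc _) , suc _) (suc zero , suc _)     _ = there (here (λ ()))

extendRows : ∀ {n m k} → ResolvingSet≤ (suc n) (suc m) k → ResolvingSet≤ (3 + n) (2 + m) (2 + k)
extendRows S = record
  { landmarks = extend (landmarks S)
  ; unique    = ((λ ()) ∷ All.map⁺ new≢shift) ∷ All.map⁺ new≢shift ∷ Unique.map⁺ shift-injective (unique S)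
  ; resolving = extend-resolving (resolving S)
  ; size≤     = s≤s (s≤s (≤-trans (≤-reflexive (length-map shift (landmarks S))) (size≤ S)))
  }
  where
  new≢shift : ∀ {a} → All.All (λ x → (a , zero) ≢ shift x) (landmarks S)
  new≢shift = All.tabulate (λ _ ())
  shift-injective : ∀ {x y} → shift {suc _} {suc _} x ≡ shift y → x ≡ y
  shift-injective refl = refl

-- The charging argument

Matrix : ℕ → ℕ → Set
Matrix n m = Fin n → Fin m → ℕ

module _ {n m : ℕ} where

  rowSum : Matrix n m → Fin n → ℕ
  rowSum M i = sum (M i)

  colSum : Matrix n m → Fin m → ℕ
  colSum M j = sum (λ i → M i j)

  total : Matrix n m → ℕ
  total M = sum (rowSum M)

  _ᵀ : Matrix n m → Matrix m n
  (M ᵀ) j i = M i j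

  total-+ : (M N : Matrix n m) → total (λ i j → M i j + N i j) ≡ total M + total N
  total-+ M N = trans (sum-cong-≗ (λ i → ∑-distrib-+ (M i) (N i))) (∑-distrib-+ (rowSum M) (rowSum N))

  total-kronecker : (a : Fin n) (b : Fin m) → total (λ i j → kronecker a i * kronecker b j) ≡ 1
  total-kronecker a b = begin
    sum (λ i → sum (λ j → kronecker a i * kronecker b j))
      ≡⟨ sum-cong-≗ (λ i → *-distribˡ-sum (kronecker a i) (kronecker b)) ⟨
    sum (λ i → kronecker a i * sum (kronecker b))
      ≡⟨ sum-cong-≗ (λ i → cong (kronecker a i *_) (sum-kronecker b)) ⟩
    sum (λ i → kronecker a i * 1)
      ≡⟨ sum-cong-≗ (λ i → *-identityʳ (kronecker a i)) ⟩
    sum (kronecker a)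
      ≡⟨ sum-kronecker a ⟩
    1 ∎
    where open ≡-Reasoning

  landmarkCount : List (Fin n × Fin m) → Matrix n m
  landmarkCount []            i j = 0
  landmarkCount ((a , b) ∷ S) i j = kronecker a i * kronecker b j + landmarkCount S i j

  total-landmarkCount : (S : List (Fin n × Fin m)) → total (landmarkCount S) ≡ length S
  total-landmarkCount []            = sum-zero {n} (λ _ → sum-zero {m} (λ _ → refl))
  total-landmarkCount ((a , b) ∷ S) =
    trans (total-+ _ (landmarkCount S)) (cong₂ _+_ (total-kronecker a b) (total-landmarkCount S))

  ∈⇒0<landmarkCount : ∀ {S x} → x ∈ S → 0 < uncurry (landmarkCount S) x
  ∈⇒0<landmarkCount {(a , b) ∷ S} (here refl) rewrite kronecker-refl a | kronecker-refl b = z<s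
  ∈⇒0<landmarkCount {(a , b) ∷ S} (there x∈S) = ≤-trans (∈⇒0<landmarkCount x∈S) (m≤n+m _ _)

  SupportResolving : Matrix n m → Set
  SupportResolving M = ∀ v w → v ≢ w → ∃[ x ] 0 < uncurry M x × Separates v w x

  Resolving⇒SupportResolving : ∀ {S} → Resolving S → SupportResolving (landmarkCount S)
  Resolving⇒SupportResolving R v w v≢w =
    let x , x∈S , sep = find (R v w v≢w) in x , ∈⇒0<landmarkCount x∈S , sep

total-ᵀ : ∀ {n m} (M : Matrix n m) → total (M ᵀ) ≡ total M
total-ᵀ M = sym (∑-comm M)

SupportResolving-ᵀ : ∀ {n m} {M : Matrix n m} → SupportResolving M → SupportResolving (M ᵀ)
SupportResolving-ᵀ res v w v≢w =
  let x , 0<M , sep = res (swap v) (swap w) (v≢w ∘ cong swap) in swap x , 0<M , separates-swap {v = v} {w} sep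

record Lonely {n m} (M : Matrix n m) (i : Fin n) (j : Fin m) : Set where
  field
    row-single : rowSum M i ≡ 1
    positive   : 0 < M i j
    col-single : colSum M j ≡ 1

  in-row : ∀ {b} → 0 < M i b → b ≡ j
  in-row 0<M = sum≡1⇒support-unique (M i) row-single 0<M positive

  in-col : ∀ {a} → 0 < M a j → a ≡ i
  in-col 0<M = sum≡1⇒support-unique (λ a → M a j) col-single 0<M positive

open Lonely

module _ {n m : ℕ} {M : Matrix n m} (res : SupportResolving M) where

  private
    empty-row : ∀ {i b} → rowSum M i ≡ 0 → 0 < M i b → ⊥
    empty-row {i} {b} e 0<M = <⇒≢ 0<M (sym (sum≡0⇒≡0 (M i) e b))

    empty-col : ∀ {a j} → colSum M j ≡ 0 → 0 < M a j → ⊥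
    empty-col {a} {j} e 0<M = <⇒≢ 0<M (sym (sum≡0⇒≡0 (λ a → M a j) e a))

  empty-rows-equal : Fin m → ∀ {i i′} → rowSum M i ≡ 0 → rowSum M i′ ≡ 0 → i ≡ i′
  empty-rows-equal c {i} {i′} e e′ with i ≟ i′
  ... | yes i≡i′ = i≡i′
  ... | no  i≢i′ with res (i , c) (i′ , c) (i≢i′ ∘ cong proj₁)
  ... | (a , b) , 0<M , sep with a ≟ i | a ≟ i′
  ... | yes refl | _        = ⊥-elim (empty-row e 0<M)
  ... | no _     | yes refl = ⊥-elim (empty-row e′ 0<M)
  ... | no a≢i   | no a≢i′  =
    ⊥-elim (sep (cong (_+ distK c b) (trans (distK-≢ (a≢i ∘ sym)) (sym (distK-≢ (a≢i′ ∘ sym))))))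

  -- Under these hypotheses no landmark separates (i , y) from (x , j).
  lonely-crossing : ∀ {i j x y} → Lonely M i j → x ≢ i → y ≢ j →
    (∀ {a b} → 0 < M a b → a ≢ i → distK x a ≡ distK y b) → ⊥
  lonely-crossing {i} {j} {x} {y} L x≢i y≢j balanced with res (i , y) (x , j) (x≢i ∘ sym ∘ cong proj₁)
  ... | (a , b) , 0<M , sep with a ≟ i
  ... | yes refl with in-row L 0<M
  ... | refl =
    sep (trans (cong₂ _+_ (distK-refl a) (distK-≢ y≢j)) (sym (cong₂ _+_ (distK-≢ x≢i) (distK-refl j))))
  lonely-crossing {i} {j} {x} {y} L x≢i y≢j balanced | (a , b) , 0<M , sep | no a≢i = sep (begin
    distK i a + distK y b ≡⟨ cong (_+ distK y b) (distK-≢ (a≢i ∘ sym)) ⟩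
    1 + distK y b         ≡⟨ +-comm 1 (distK y b) ⟩
    distK y b + 1         ≡⟨ cong₂ _+_ (balanced 0<M a≢i) (distK-≢ j≢b) ⟨
    distK x a + distK j b ∎)
    where
    open ≡-Reasoning
    j≢b : j ≢ b
    j≢b refl = a≢i (in-col L 0<M)

  lonely-rows-equal : ∀ {i j i′ j′} → Lonely M i j → Lonely M i′ j′ → i ≡ i′
  lonely-rows-equal {i} {j} {i′} {j′} L L′ with i ≟ i′
  ... | yes i≡i′ = i≡i′
  ... | no  i≢i′ = ⊥-elim (lonely-crossing L (i≢i′ ∘ sym) j′≢j balanced)
    where
    j′≢j : j′ ≢ j
    j′≢j refl = i≢i′ (sym (in-col L (positive L′)))
    balanced : ∀ {a b} → 0 < M a b → a ≢ i → distK i′ a ≡ distK j′ b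
    balanced {a} {b} 0<M _ with a ≟ i′
    ... | yes refl with in-row L′ 0<M
    ...   | refl = trans (distK-refl a) (sym (distK-refl b))
    balanced {a} {b} 0<M _ | no a≢i′ =
      trans (distK-≢ (a≢i′ ∘ sym)) (sym (distK-≢ {a = j′} λ { refl → a≢i′ (in-col L′ 0<M) }))

  lonely-avoids-empty-lines : ∀ {i₀ j₀ i j} → rowSum M i₀ ≡ 0 → colSum M j₀ ≡ 0 → ¬ Lonely M i j
  lonely-avoids-empty-lines {i₀} {j₀} e f L = lonely-crossing {x = i₀} {y = j₀} L
    (λ { refl → empty-row e (positive L) }) (λ { refl → empty-col f (positive L) })
    (λ 0<M _ → trans (distK-≢ {a = i₀} λ { refl → empty-row e 0<M })
                     (sym (distK-≢ {a = j₀} λ { refl → empty-col f 0<M })))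

-- The part of a landmark's 6 units received by its line of size r, the crossing line
-- having size c.
share : ℕ → ℕ → ℕ
share (suc zero) (suc zero) = 3
share (suc zero) _          = 4
share _          (suc zero) = 2
share _          _          = 3

share-sum : ∀ r c → share r c + share c r ≡ 6
share-sum zero             zero             = refl
share-sum zero             (suc zero)       = refl
share-sum zero             (suc (suc _))    = refl
share-sum (suc zero)       zero             = refl
share-sum (suc zero)       (suc zero)       = refl
share-sum (suc zero)       (suc (suc _))    = refl
share-sum (suc (suc _))    zero             = refl
share-sum (suc (suc _))    (suc zero)       = refl
share-sum (suc (suc _))    (suc (suc _))    = refl

χ₀ : ℕ → ℕ
χ₀ zero    = 1
χ₀ (suc _) = 0

χ₁ : ℕ → ℕ
χ₁ (suc zero) = 1
χ₁ _          = 0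

share-single : ∀ c → share 1 c + χ₁ c ≡ 4
share-single zero          = refl
share-single (suc zero)    = refl
share-single (suc (suc _)) = refl

share-multiple : ∀ r c → 2 ≤ share (2 + r) c
share-multiple r zero          = s≤s (s≤s z≤n)
share-multiple r (suc zero)    = s≤s (s≤s z≤n)
share-multiple r (suc (suc _)) = s≤s (s≤s z≤n)

χ₀≤1 : ∀ r → χ₀ r ≤ 1
χ₀≤1 zero    = ≤-refl
χ₀≤1 (suc _) = z≤n

χ₁≤1 : ∀ r → χ₁ r ≤ 1
χ₁≤1 zero          = z≤n
χ₁≤1 (suc zero)    = ≤-refl
χ₁≤1 (suc (suc _)) = z≤n

χ₀-positive : ∀ {r} → 0 < χ₀ r → r ≡ 0
χ₀-positive {zero} _ = refl

χ₁-positive : ∀ {r} → 0 < χ₁ r → r ≡ 1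
χ₁-positive {suc zero} _ = refl

1≤n+χ₀n : ∀ r → 1 ≤ r + χ₀ r
1≤n+χ₀n zero    = ≤-refl
1≤n+χ₀n (suc _) = s≤s z≤n

χ₁*≤1 : ∀ r s → (r ≡ 1 → s ≤ 1) → χ₁ r * s ≤ 1
χ₁*≤1 zero          s _    = z≤n
χ₁*≤1 (suc zero)    s s≤1 = ≤-trans (≤-reflexive (+-identityʳ s)) (s≤1 refl)
χ₁*≤1 (suc (suc _)) s _    = z≤n

0<m*n⇒0<m×0<n : ∀ m n → 0 < m * n → 0 < m × 0 < n
0<m*n⇒0<m×0<n (suc m) zero    0<m*0 rewrite *-zeroʳ m = contradiction 0<m*0 λ ()
0<m*n⇒0<m×0<n (suc m) (suc n) _     = z<s , z<s

line-charge : ∀ {m} (f c : Fin m → ℕ) →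
  4 ≤ sum (λ j → f j * share (sum f) (c j)) + 4 * χ₀ (sum f) + χ₁ (sum f) * sum (λ j → f j * χ₁ (c j))
line-charge f c with sum f in eq
... | zero = ≤-trans (m≤n+m 4 _) (m≤m+n _ 0)
... | suc zero = ≤-reflexive (begin
  4                                  ≡⟨ cong (4 *_) eq ⟨
  4 * sum f                          ≡⟨ *-distribˡ-sum 4 f ⟩
  sum (λ j → 4 * f j)                ≡⟨ sum-cong-≗ (λ j → split (f j) (c j)) ⟩
  sum (λ j → shares j + lonely j)    ≡⟨ ∑-distrib-+ shares lonely ⟩
  sum shares + sum lonely            ≡⟨ cong₂ _+_ (+-identityʳ (sum shares)) (+-identityʳ (sum lonely)) ⟨
  sum shares + 0 + (sum lonely + 0)  ∎)
  where
  open ≡-Reasoning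
  shares lonely : Fin _ → ℕ
  shares j = f j * share 1 (c j)
  lonely j = f j * χ₁ (c j)
  split : ∀ x c → 4 * x ≡ x * share 1 c + x * χ₁ c
  split x c = trans (*-comm 4 x) (trans (cong (x *_) (sym (share-single c))) (*-distribˡ-+ x (share 1 c) (χ₁ c)))
... | suc (suc r) = ≤-trans (begin
  4                                       ≤⟨ *-monoʳ-≤ 2 (s≤s (s≤s z≤n)) ⟩
  2 * (2 + r)                             ≡⟨ cong (2 *_) eq ⟨
  2 * sum f                               ≡⟨ *-distribˡ-sum 2 f ⟩
  sum (λ j → 2 * f j)                     ≤⟨ sum-mono-≤ (λ j → ≤-trans (≤-reflexive (*-comm 2 (f j)))
                                                                 (*-monoʳ-≤ (f j) (share-multiple r (c j)))) ⟩
  sum (λ j → f j * share (2 + r) (c j))   ∎) (≤-trans (m≤m+n _ 0) (m≤m+n _ 0))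
  where open ≤-Reasoning

module _ {n m : ℕ} where

  rowCharge : Matrix n m → Fin n → ℕ
  rowCharge M i = sum (λ j → M i j * share (rowSum M i) (colSum M j))

  lonelyCount : Matrix n m → Fin n → ℕ
  lonelyCount M i = χ₁ (rowSum M i) * sum (λ j → M i j * χ₁ (colSum M j))

  rows-charge : (M : Matrix n m) →
    4 * n ≤ sum (rowCharge M) + 4 * sum (χ₀ ∘ rowSum M) + sum (lonelyCount M)
  rows-charge M = begin
    4 * n                                                          ≡⟨ *-comm 4 n ⟩
    n * 4                                                          ≡⟨ sum-const n 4 ⟨
    sum {n} (λ _ → 4)                                              ≤⟨ sum-mono-≤ (λ i → line-charge (M i) (colSum M)) ⟩
    sum (λ i → rowCharge M i + 4 * χ₀ (rowSum M i) + lonelyCount M i)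
      ≡⟨ ∑-distrib-+ (λ i → rowCharge M i + 4 * χ₀ (rowSum M i)) (lonelyCount M) ⟩
    sum (λ i → rowCharge M i + 4 * χ₀ (rowSum M i)) + sum (lonelyCount M)
      ≡⟨ cong (_+ sum (lonelyCount M)) (∑-distrib-+ (rowCharge M) (λ i → 4 * χ₀ (rowSum M i))) ⟩
    sum (rowCharge M) + sum (λ i → 4 * χ₀ (rowSum M i)) + sum (lonelyCount M)
      ≡⟨ cong (λ t → sum (rowCharge M) + t + sum (lonelyCount M)) (*-distribˡ-sum 4 (χ₀ ∘ rowSum M)) ⟨
    sum (rowCharge M) + 4 * sum (χ₀ ∘ rowSum M) + sum (lonelyCount M) ∎
    where open ≤-Reasoning

charge-conservation : ∀ {n m} (M : Matrix n m) → sum (rowCharge M) + sum (rowCharge (M ᵀ)) ≡ 6 * total M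
charge-conservation M = begin
  sum (rowCharge M) + sum (rowCharge (M ᵀ))
    ≡⟨ cong (sum (rowCharge M) +_) (∑-comm (λ i j → M i j * share (colSum M j) (rowSum M i))) ⟨
  sum (rowCharge M) + sum (λ i → sum (λ j → M i j * share (colSum M j) (rowSum M i)))
    ≡⟨ ∑-distrib-+ (rowCharge M) _ ⟨
  sum (λ i → rowCharge M i + sum (λ j → M i j * share (colSum M j) (rowSum M i)))
    ≡⟨ sum-cong-≗ (λ i → ∑-distrib-+ (λ j → M i j * share (rowSum M i) (colSum M j))
                                     (λ j → M i j * share (colSum M j) (rowSum M i))) ⟨
  sum (λ i → sum (λ j → M i j * share (rowSum M i) (colSum M j) + M i j * share (colSum M j) (rowSum M i)))
    ≡⟨ sum-cong-≗ (λ i → sum-cong-≗ (λ j → six (M i j) (rowSum M i) (colSum M j))) ⟩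
  sum (λ i → sum (λ j → 6 * M i j))
    ≡⟨ sum-cong-≗ (λ i → *-distribˡ-sum 6 (M i)) ⟨
  sum (λ i → 6 * rowSum M i)
    ≡⟨ *-distribˡ-sum 6 (rowSum M) ⟨
  6 * total M ∎
  where
  open ≡-Reasoning
  six : ∀ x r c → x * share r c + x * share c r ≡ 6 * x
  six x r c = trans (sym (*-distribˡ-+ x (share r c) (share c r))) (trans (cong (x *_) (share-sum r c)) (*-comm x 6))

module _ {n m : ℕ} {M : Matrix n m} (res : SupportResolving M) where

  empty-rows≤1 : Fin m → sum (χ₀ ∘ rowSum M) ≤ 1
  empty-rows≤1 c = sum≤1 (χ₀ ∘ rowSum M) (χ₀≤1 ∘ rowSum M)
    (λ p q → empty-rows-equal res c (χ₀-positive p) (χ₀-positive q))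

  lonelyCount-positive : ∀ {i} → 0 < lonelyCount M i → ∃[ j ] Lonely M i j
  lonelyCount-positive {i} p =
    let χ₁r , 0<s = 0<m*n⇒0<m×0<n (χ₁ (rowSum M i)) _ p
        j , q     = sum-positive (λ j → M i j * χ₁ (colSum M j)) 0<s
        0<M , χ₁c = 0<m*n⇒0<m×0<n (M i j) (χ₁ (colSum M j)) q
    in j , record { row-single = χ₁-positive χ₁r ; positive = 0<M ; col-single = χ₁-positive χ₁c }

  lonelyCount≤1 : ∀ i → lonelyCount M i ≤ 1
  lonelyCount≤1 i = χ₁*≤1 (rowSum M i) _ (λ r≡1 → ≤-trans
    (sum-mono-≤ (λ j → ≤-trans (*-monoʳ-≤ (M i j) (χ₁≤1 (colSum M j))) (≤-reflexive (*-identityʳ (M i j)))))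
    (≤-reflexive r≡1))

  lonely-rows≤1 : sum (lonelyCount M) ≤ 1
  lonely-rows≤1 = sum≤1 (lonelyCount M) lonelyCount≤1
    (λ p q → lonely-rows-equal res (proj₂ (lonelyCount-positive p)) (proj₂ (lonelyCount-positive q)))

  no-lonely-rows : 0 < sum (χ₀ ∘ rowSum M) → 0 < sum (χ₀ ∘ colSum M) → sum (lonelyCount M) ≡ 0
  no-lonely-rows p q =
    let i₀ , χ₀r = sum-positive (χ₀ ∘ rowSum M) p
        j₀ , χ₀c = sum-positive (χ₀ ∘ colSum M) q
    in sum-zero {f = lonelyCount M} (λ i → n≤0⇒n≡0 (≮⇒≥ (λ 0<l →
         lonely-avoids-empty-lines res (χ₀-positive χ₀r) (χ₀-positive χ₀c) (proj₂ (lonelyCount-positive 0<l)))))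

  row-count-bound : Fin m → n ≤ total M + 1
  row-count-bound c = begin
    n                                               ≡⟨ trans (sym (*-identityʳ n)) (sym (sum-const n 1)) ⟩
    sum {n} (λ _ → 1)                               ≤⟨ sum-mono-≤ (λ i → 1≤n+χ₀n (rowSum M i)) ⟩
    sum (λ i → rowSum M i + χ₀ (rowSum M i))        ≡⟨ ∑-distrib-+ (rowSum M) (χ₀ ∘ rowSum M) ⟩
    total M + sum (χ₀ ∘ rowSum M)                   ≤⟨ +-monoʳ-≤ (total M) (empty-rows≤1 c) ⟩
    total M + 1                                     ∎
    where open ≤-Reasoning

corrections≤8 : ∀ {zr zc lr lc} → zr ≤ 1 → zc ≤ 1 → lr ≤ 1 → lc ≤ 1 →
  (0 < zr → 0 < zc → lr ≡ 0 × lc ≡ 0) → 4 * zr + 4 * zc + lr + lc ≤ 8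
corrections≤8 z≤n       z≤n       lr≤1 lc≤1 _ = ≤-trans (+-mono-≤ lr≤1 lc≤1) (m≤m+n 2 6)
corrections≤8 z≤n       (s≤s z≤n) lr≤1 lc≤1 _ = ≤-trans (+-mono-≤ (+-monoʳ-≤ 4 lr≤1) lc≤1) (m≤m+n 6 2)
corrections≤8 (s≤s z≤n) z≤n       lr≤1 lc≤1 _ = ≤-trans (+-mono-≤ (+-monoʳ-≤ 4 lr≤1) lc≤1) (m≤m+n 6 2)
corrections≤8 (s≤s z≤n) (s≤s z≤n) _    _    none with none z<s z<s
... | refl , refl = ≤-refl

perimeter-bound : ∀ {n m} {M : Matrix n m} → SupportResolving M → Fin n → Fin m →
  4 * (n + m) ≤ 6 * total M + 8
perimeter-bound {n} {m} {M} res r c = begin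
  4 * (n + m)
    ≡⟨ *-distribˡ-+ 4 n m ⟩
  4 * n + 4 * m
    ≤⟨ +-mono-≤ (rows-charge M) (rows-charge (M ᵀ)) ⟩
  (chargeᵣ + 4 * emptyᵣ + lonelyᵣ) + (chargeᶜ + 4 * emptyᶜ + lonelyᶜ)
    ≡⟨ rearrange chargeᵣ (4 * emptyᵣ) lonelyᵣ chargeᶜ (4 * emptyᶜ) lonelyᶜ ⟩
  (chargeᵣ + chargeᶜ) + (4 * emptyᵣ + 4 * emptyᶜ + lonelyᵣ + lonelyᶜ)
    ≤⟨ +-mono-≤ (≤-reflexive (charge-conservation M))
         (corrections≤8 (empty-rows≤1 res c) (empty-rows≤1 resᵀ r) (lonely-rows≤1 res) (lonely-rows≤1 resᵀ)
           (λ p q → no-lonely-rows res p q , no-lonely-rows resᵀ q p)) ⟩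
  6 * total M + 8
    ∎
  where
  open ≤-Reasoning
  resᵀ = SupportResolving-ᵀ res
  chargeᵣ = sum (rowCharge M)
  chargeᶜ = sum (rowCharge (M ᵀ))
  emptyᵣ = sum (χ₀ ∘ rowSum M)
  emptyᶜ = sum (χ₀ ∘ colSum M)
  lonelyᵣ = sum (lonelyCount M)
  lonelyᶜ = sum (lonelyCount (M ᵀ))
  rearrange : ∀ a b c d e f → (a + b + c) + (d + e + f) ≡ (a + d) + (b + e + c + f)
  rearrange = solve-∀

-- Admissible sizes

record Admissible (n m k : ℕ) : Set where
  field
    perimeter : 2 * (n + m) ≤ 3 * k + 4
    rows      : n ≤ suc k
    columns   : m ≤ suc k

open Admissible

lower-bound : ∀ {n m} {S : List (Fin (suc n) × Fin (suc m))} → Resolving S → Admissible (suc n) (suc m) (length S)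
lower-bound {n} {m} {S} R = record
  { perimeter = *-cancelˡ-≤ 2 (begin
      2 * (2 * (suc n + suc m)) ≡⟨ double (suc n + suc m) ⟩
      4 * (suc n + suc m)       ≤⟨ perimeter-bound res zero zero ⟩
      6 * total L + 8           ≡⟨ cong (λ t → 6 * t + 8) (total-landmarkCount S) ⟩
      6 * length S + 8          ≡⟨ halve (length S) ⟩
      2 * (3 * length S + 4)    ∎)
  ; rows    = ≤-trans (row-count-bound res zero) (≤-reflexive (+1≡suc (total-landmarkCount S)))
  ; columns = ≤-trans (row-count-bound resᵀ zero) (≤-reflexive (+1≡suc (trans (total-ᵀ L) (total-landmarkCount S))))
  }
  where
  open ≤-Reasoning
  L = landmarkCount S
  res = Resolving⇒SupportResolving R
  resᵀ = SupportResolving-ᵀ res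
  double : ∀ x → 2 * (2 * x) ≡ 4 * x
  double = solve-∀
  halve : ∀ l → 6 * l + 8 ≡ 2 * (3 * l + 4)
  halve = solve-∀
  +1≡suc : ∀ {t l} → t ≡ l → t + 1 ≡ suc l
  +1≡suc {t} refl = +-comm t 1

Admissible-transpose : ∀ {n m k} → Admissible n m k → Admissible m n k
Admissible-transpose {n} {m} {k} a = record
  { perimeter = subst (λ t → 2 * t ≤ 3 * k + 4) (+-comm n m) (perimeter a)
  ; rows      = columns a
  ; columns   = rows a
  }

2[2m+1]≤3k+4⇒m≤k : ∀ {m k} → 2 * (m + suc m) ≤ 3 * k + 4 → m ≤ k
2[2m+1]≤3k+4⇒m≤k {m} {k} h = ≮⇒≥ λ k<m → m+1+n≰m (3 * k + 4) (begin
  3 * k + 4 + suc (suc k)     ≡⟨ lhs k ⟩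
  2 * (suc k + suc (suc k))   ≤⟨ *-monoʳ-≤ 2 (+-mono-≤ k<m (s≤s k<m)) ⟩
  2 * (m + suc m)             ≤⟨ h ⟩
  3 * k + 4                   ∎)
  where
  open ≤-Reasoning
  lhs : ∀ k → 3 * k + 4 + suc (suc k) ≡ 2 * (suc k + suc (suc k))
  lhs = solve-∀

private
  perimeter+6 : ∀ n m → 2 * (2 + n + (2 + m)) ≡ 2 * (n + suc m) + 6
  perimeter+6 = solve-∀

  bound+6 : ∀ k → 3 * (2 + k) + 4 ≡ 3 * k + 4 + 6
  bound+6 = solve-∀

Admissible-shrink : ∀ {n m k} → Admissible (2 + n) (2 + m) (2 + k) → m ≤ n → Admissible n (suc m) k
Admissible-shrink {n} {m} {k} a m≤n = record
  { perimeter = perimeter′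
  ; rows      = s≤s⁻¹ (s≤s⁻¹ (rows a))
  ; columns   = s≤s (2[2m+1]≤3k+4⇒m≤k (≤-trans (*-monoʳ-≤ 2 (+-monoˡ-≤ (suc m) m≤n)) perimeter′))
  }
  where
  perimeter′ : 2 * (n + suc m) ≤ 3 * k + 4
  perimeter′ = +-cancelʳ-≤ 6 _ _ (subst₂ _≤_ (perimeter+6 n m) (bound+6 k) (perimeter a))

Admissible-grow : ∀ {n m k} → Admissible n (suc m) k → Admissible (2 + n) (2 + m) (2 + k)
Admissible-grow {n} {m} {k} a = record
  { perimeter = subst₂ _≤_ (sym (perimeter+6 n m)) (sym (bound+6 k)) (+-monoˡ-≤ 6 (perimeter a))
  ; rows      = s≤s (s≤s (rows a))
  ; columns   = s≤s (m≤n⇒m≤1+n (columns a))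
  }

Admissible-step : ∀ {n m k} → Admissible (3 + n) (3 + m) (2 + k) →
  Admissible (1 + n) (2 + m) k ⊎ Admissible (2 + n) (1 + m) k
Admissible-step {n} {m} a with m ≤? n
... | yes m≤n = inj₁ (Admissible-shrink a (s≤s m≤n))
... | no  m≰n = inj₂ (Admissible-transpose (Admissible-shrink (Admissible-transpose a) (s≤s (≰⇒≥ m≰n))))

square-size : ∀ {k} → Admissible 2 2 k → 2 ≤ k
square-size {0}           a with perimeter a
... | s≤s (s≤s (s≤s (s≤s ())))
square-size {1}           a with perimeter a
... | s≤s (s≤s (s≤s (s≤s (s≤s (s≤s (s≤s ()))))))
square-size {suc (suc k)} _ = s≤s (s≤s z≤n)

upper-bound : ∀ {n m k} → Admissible (suc n) (suc m) k → ResolvingSet≤ (suc n) (suc m) k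
upper-bound-tall : ∀ {n m k} → Admissible (2 + n) (2 + m) k → m ≤ n → ResolvingSet≤ (2 + n) (2 + m) k

upper-bound {zero}          a = widen (s≤s⁻¹ (columns a)) (line _)
upper-bound {suc n} {zero}  a = widen (s≤s⁻¹ (rows a)) (transpose (line (suc n)))
upper-bound {suc n} {suc m} a with m ≤? n
... | yes m≤n = upper-bound-tall a m≤n
... | no  m≰n = transpose (upper-bound-tall (Admissible-transpose a) (≰⇒≥ m≰n))

upper-bound-tall {zero}  {zero}            a _   = widen (square-size a) square
upper-bound-tall {suc n} {k = suc (suc k)} a m≤n = extendRows (upper-bound (Admissible-shrink a m≤n))
upper-bound-tall {suc n} {k = 0}           a _ with rows a
... | s≤s ()
upper-bound-tall {suc n} {k = 1}           a _ with rows a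
... | s≤s (s≤s ())

IsLeast : (ℕ → Set) → ℕ → Set
IsLeast P a = P a × (∀ k → P k → a ≤ k)

least-shift : ∀ {P Q R : ℕ → Set} {d a b c} →
  (∀ {k} → P k → d ≤ k) → (∀ {k} → P (d + k) → Q k ⊎ R k) →
  (∀ {k} → Q k → P (d + k)) → (∀ {k} → R k → P (d + k)) →
  IsLeast P a → IsLeast Q b → IsLeast R c → a ≡ d + b ⊓ c
least-shift {P} {Q} {R} {d} {a} {b} {c} P⇒d≤ split Q⇒P R⇒P (Pa , a-least) (Qb , b-least) (Rc , c-least) =
  ≤-antisym a≤d+b⊓c d+b⊓c≤a
  where
  a≤d+b⊓c : a ≤ d + b ⊓ c
  a≤d+b⊓c = subst (a ≤_) (sym (+-distribˡ-⊓ d b c)) (⊓-glb (a-least _ (Q⇒P Qb)) (a-least _ (R⇒P Rc)))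
  d+[a∸d]≡a : d + (a ∸ d) ≡ a
  d+[a∸d]≡a = m+[n∸m]≡n (P⇒d≤ Pa)
  b⊓c≤a∸d : Q (a ∸ d) ⊎ R (a ∸ d) → b ⊓ c ≤ a ∸ d
  b⊓c≤a∸d (inj₁ Qa∸d) = ≤-trans (m⊓n≤m b c) (b-least _ Qa∸d)
  b⊓c≤a∸d (inj₂ Ra∸d) = ≤-trans (m⊓n≤n b c) (c-least _ Ra∸d)
  d+b⊓c≤a : d + b ⊓ c ≤ a
  d+b⊓c≤a = subst (d + b ⊓ c ≤_) d+[a∸d]≡a (+-monoʳ-≤ d (b⊓c≤a∸d (split (subst P (sym d+[a∸d]≡a) Pa))))

IsMetricDim⇒IsLeast : ∀ {n m a} → IsMetricDim (K (suc n) □ K (suc m)) a →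
  IsLeast (Admissible (suc n) (suc m)) a
IsMetricDim⇒IsLeast ((S , _ , R , refl) , minimal) =
  lower-bound (IsResolvingSet⇒Resolving R) ,
  λ k adm → let T = upper-bound adm in
    ≤-trans (minimal (landmarks T) (unique T) (Resolving⇒IsResolvingSet (resolving T))) (size≤ T)

lemma6p4 : (n m : ℕ) → 3 ≤ n → 3 ≤ m →
    (a b c : ℕ) →
    IsMetricDim (K n □ K m) a →
    IsMetricDim (K (n ∸ 2) □ K (m ∸ 1)) b →
    IsMetricDim (K (n ∸ 1) □ K (m ∸ 2)) c →
    a ≡ 2 + (b ⊓ c)
lemma6p4 _ _ (s≤s (s≤s (s≤s _))) (s≤s (s≤s (s≤s _))) a b c A B C =
  least-shift (λ adm → ≤-trans (m≤m+n 2 _) (s≤s⁻¹ (rows adm))) Admissible-step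
    Admissible-grow (Admissible-transpose ∘ Admissible-grow ∘ Admissible-transpose)
    (IsMetricDim⇒IsLeast A) (IsMetricDim⇒IsLeast B) (IsMetricDim⇒IsLeast C)
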